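{- Let $f$ be an endomorphism of $\{a,b\}^*$ (with $a \prec b$) that preserves the lexicographic order on finite words. Assume that $i \geq 2$ is an integer and that $f(ab^i)$ is a power of a Lyndon word $u$. Then $|u| > |f(b)|$.
   Context: The lexicographic order $\prec$ on finite words over $\{a \prec b\}$: $u \prec v$ iff $u$ is a proper prefix of $v$, or $u = x\alpha y$, $v = x\beta z$ with letters $\alpha \prec \beta$. A non-empty finite word $w$ is a Lyndon word if $w \prec s$ for every non-empty proper suffix $s$ of $w$. $f$ preserves the lexicographic order on finite words if for all finite words $u,v$, $u \prec v$ implies $f(u) \prec f(v)$. A power of $u$ means $u^n$ for an integer $n \ge 1$; $|w|$ is the length of $w$. -}

module Defs where

open import Data.Nat using (ℕ; suc; _<_)
open import Data.List using (List; []; _∷_; _++_; concatMap; length; replicate)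
open import Data.Product using (Σ; ∃; _×_; _,_)
open import Relation.Binary.PropositionalEquality using (_≡_; _≢_)

data Letter : Set where
  a b : Letter

data _<ₗ_ : Letter → Letter → Set where
  a<b : a <ₗ b

Word : Set
Word = List Letter

data _≺_ : Word → Word → Set where
  prefix : ∀ {c v} → [] ≺ (c ∷ v)
  differ : ∀ {α β u v} → α <ₗ β → (α ∷ u) ≺ (β ∷ v)
  same   : ∀ {c u v} → u ≺ v → (c ∷ u) ≺ (c ∷ v)

-- Endomorphisms of {a,b}^* : monoid morphisms, determined by the images of the letters.
Morphism : Set
Morphism = Letter → Word

apply : Morphism → Word → Word
apply f = concatMap f

PreservesLex : Morphism → Set
PreservesLex f = ∀ u v → u ≺ v → apply f u ≺ apply f v

IsLyndon : Word → Set
IsLyndon w = (w ≢ []) × (∀ p s → p ≢ [] → s ≢ [] → w ≡ p ++ s → w ≺ s)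

pow : Word → ℕ → Word
pow u 0 = []
pow u (suc n) = u ++ pow u n

IsPowerOf : Word → Word → Set
IsPowerOf w u = ∃ λ n → (1 Data.Nat.≤ n) × (w ≡ pow u n)

{-# OPTIONS --safe #-}
module Submission where

open import Defs
open import Data.Nat using (ℕ; _≤_; _<_; zero; suc; z≤n; s≤s; _≤?_)
open import Data.Nat.Properties
  using (≤-total; +-monoʳ-<; <⇒≱; ≰⇒>)
open import Data.List using (List; []; _∷_; length; replicate; _++_)
open import Data.List.Properties
  using (++-assoc; ++-identityʳ; ++-identityʳ-unique; ++-conicalʳ; length-++; length-++-≤ˡ; length-++-≤ʳ; ∷-injective)
open import Data.Product using (∃; _×_; _,_)
open import Data.Sum using (inj₁; inj₂)
open import Data.Empty using (⊥; ⊥-elim)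
open import Relation.Nullary using (yes; no)
open import Relation.Binary.PropositionalEquality

-- A Lyndon word u is unbordered, so every occurrence of u in a power of u
-- is aligned with the factorisation u·u·…·u. Write y = f(b). If |y| ≥ |u|, then since
-- f(ab^i) = f(ab^(i-2)) y y = u^N, the last y contains an occurrence of u aligned in
-- this way, which forces y itself to be a power of u. But ab^i ≺ b gives
-- u^N = f(ab^i) ≺ f(b) = y, and comparable powers of u are ordered by length, so
-- |u^N| < |y|, contradicting that y is a suffix of u^N.

++-split : ∀ A B {C D : Word} → A ++ C ≡ B ++ D → length C ≤ length D →
           ∃ λ R → A ≡ B ++ R × D ≡ R ++ C
++-split A       []      eq _  = A , refl , sym eq
++-split []      (x ∷ B) {D = D} refl C≤D =
  ⊥-elim (<⇒≱ C≤D (length-++-≤ʳ D {B}))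
++-split (y ∷ A) (x ∷ B) eq C≤D with ∷-injective eq
... | refl , eq′ with ++-split A B eq′ C≤D
...   | R , A≡BR , D≡RC = R , cong (x ∷_) A≡BR , D≡RC

pow-suc-++ : ∀ u n → pow u (suc n) ≡ pow u n ++ u
pow-suc-++ u zero    = ++-identityʳ u
pow-suc-++ u (suc n) = trans (cong (u ++_) (pow-suc-++ u n)) (sym (++-assoc u (pow u n) u))

apply-replicate : ∀ f n c → apply f (replicate n c) ≡ pow (f c) n
apply-replicate f zero    c = refl
apply-replicate f (suc n) c = cong (f c ++_) (apply-replicate f n c)

≺-asym : ∀ {u v} → u ≺ v → v ≺ u → ⊥
≺-asym (differ a<b) (differ ())
≺-asym (same p)     (same q)     = ≺-asym p q

≺-++ : ∀ (u : Word) {v} → v ≢ [] → u ≺ (u ++ v)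
≺-++ []      {[]}    v≢[] = ⊥-elim (v≢[] refl)
≺-++ []      {c ∷ v} _    = prefix
≺-++ (c ∷ u)         v≢[] = same (≺-++ u v≢[])

≺-cancelˡ : ∀ (u : Word) {v w} → (u ++ v) ≺ (u ++ w) → v ≺ w
≺-cancelˡ []      p        = p
≺-cancelˡ (c ∷ u) (same p) = ≺-cancelˡ u p

[]≺⇒0<length : ∀ {v} → [] ≺ v → 0 < length v
[]≺⇒0<length prefix = s≤s z≤n

pow-≺⇒length-< : ∀ u m k → pow u m ≺ pow u k → length (pow u m) < length (pow u k)
pow-≺⇒length-< u zero    k       p = []≺⇒0<length p
pow-≺⇒length-< u (suc m) zero    ()
pow-≺⇒length-< u (suc m) (suc k) p =
  subst₂ _<_ (sym (length-++ u)) (sym (length-++ u))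
    (+-monoʳ-< (length u) (pow-≺⇒length-< u m k (≺-cancelˡ u p)))

Unbordered : Word → Set
Unbordered u = ∀ {p s q} → p ≢ [] → s ≢ [] → q ≢ [] → u ≡ p ++ s → u ≡ s ++ q → ⊥

-- A border s is a proper suffix of u with s ≺ u, against minimality of u.
Lyndon⇒Unbordered : ∀ {u} → IsLyndon u → Unbordered u
Lyndon⇒Unbordered (_ , u≺suffix) {p} {s} p≢[] s≢[] q≢[] u≡ps u≡sq =
  ≺-asym (u≺suffix p s p≢[] s≢[] u≡ps) (subst (s ≺_) (sym u≡sq) (≺-++ s q≢[]))

Unbordered-shift : ∀ {u} → Unbordered u → ∀ T R → T ++ u ≡ u ++ R → R ≢ [] →
                   ∃ λ R′ → T ≡ u ++ R′ × R ≡ R′ ++ u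
Unbordered-shift {u} ub []      R eq R≢[] = ⊥-elim (R≢[] (++-identityʳ-unique u eq))
Unbordered-shift {u} ub (t ∷ T) R eq R≢[] with ≤-total (length u) (length R)
... | inj₁ u≤R = ++-split (t ∷ T) u eq u≤R
... | inj₂ R≤u with ++-split u (t ∷ T) (sym eq) R≤u
...   | []      , u≡T++[] , u≡R =
  [] , trans (sym (++-identityʳ (t ∷ T))) (trans (sym u≡T++[]) (sym (++-identityʳ u))) , sym u≡R
...   | (s ∷ S) , u≡TS    , u≡SR = ⊥-elim (ub {t ∷ T} (λ ()) (λ ()) R≢[] u≡TS u≡SR)

pow-occurrence-aligned : ∀ {u} → Unbordered u → ∀ m X R → X ++ u ++ R ≡ pow u m →
                         ∃ λ j → R ≡ pow u j
pow-occurrence-aligned {u} ub zero    X R       eq = 0 , ++-conicalʳ u R (++-conicalʳ X (u ++ R) eq)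
pow-occurrence-aligned {u} ub (suc m) X []      eq = 0 , refl
pow-occurrence-aligned {u} ub (suc m) X (c ∷ R) eq
  with ++-split (pow u m) X (trans (sym (pow-suc-++ u m)) (sym eq)) (length-++-≤ˡ u)
... | T , uᵐ≡XT , uR≡Tu with Unbordered-shift ub T (c ∷ R) (sym uR≡Tu) (λ ())
...   | R′ , T≡uR′ , R≡R′u with pow-occurrence-aligned ub m X R′ (sym (trans uᵐ≡XT (cong (X ++_) T≡uR′)))
...     | j , R′≡uʲ = suc j , trans R≡R′u (trans (cong (_++ u) R′≡uʲ) (sym (pow-suc-++ u j)))

square-suffix-of-pow : ∀ {u} → Unbordered u → ∀ n Z v → (Z ++ v) ++ v ≡ pow u (suc n) →
                       length u ≤ length v → ∃ λ j → v ≡ pow u (suc j)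
square-suffix-of-pow {u} ub n Z v eq u≤v
  with ++-split (pow u n) (Z ++ v) (trans (sym (pow-suc-++ u n)) (sym eq)) u≤v
... | R , uⁿ≡ZvR , refl with pow-occurrence-aligned ub n (Z ++ R) R uⁿ≡ZRuR
  where
  open ≡-Reasoning
  uⁿ≡ZRuR : (Z ++ R) ++ u ++ R ≡ pow u n
  uⁿ≡ZRuR = sym (begin
    pow u n                ≡⟨ uⁿ≡ZvR ⟩
    (Z ++ (R ++ u)) ++ R   ≡⟨ ++-assoc Z (R ++ u) R ⟩
    Z ++ ((R ++ u) ++ R)   ≡⟨ cong (Z ++_) (++-assoc R u R) ⟩
    Z ++ (R ++ (u ++ R))   ≡⟨ sym (++-assoc Z R (u ++ R)) ⟩
    (Z ++ R) ++ (u ++ R)   ∎)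
... | j , R≡uʲ = j , trans (cong (_++ u) R≡uʲ) (sym (pow-suc-++ u j))

apply-abⁱ : ∀ f k → apply f (a ∷ replicate (suc (suc k)) b) ≡ ((f a ++ pow (f b) k) ++ f b) ++ f b
apply-abⁱ f k = begin
  f a ++ apply f (replicate (suc (suc k)) b)  ≡⟨ cong (f a ++_) (apply-replicate f (suc (suc k)) b) ⟩
  f a ++ pow (f b) (suc (suc k))              ≡⟨ cong (f a ++_) (pow-suc-++ (f b) (suc k)) ⟩
  f a ++ (pow (f b) (suc k) ++ f b)           ≡⟨ cong (λ w → f a ++ (w ++ f b)) (pow-suc-++ (f b) k) ⟩
  f a ++ ((pow (f b) k ++ f b) ++ f b)        ≡⟨ sym (++-assoc (f a) (pow (f b) k ++ f b) (f b)) ⟩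
  (f a ++ (pow (f b) k ++ f b)) ++ f b        ≡⟨ cong (_++ f b) (sym (++-assoc (f a) (pow (f b) k) (f b))) ⟩
  ((f a ++ pow (f b) k) ++ f b) ++ f b        ∎
  where open ≡-Reasoning

lemma4 : (f : Morphism) → PreservesLex f → (i : ℕ) → 2 ≤ i → (u : Word) →
         IsLyndon u → IsPowerOf (apply f (a ∷ replicate i b)) u →
         length (f b) < length u
lemma4 f pres (suc (suc k)) (s≤s (s≤s z≤n)) u lyndon (suc n , _ , image≡uᴺ)
  with length u ≤? length (f b)
... | no  u≰y = ≰⇒> u≰y
... | yes u≤y with square-suffix-of-pow (Lyndon⇒Unbordered lyndon) n (f a ++ pow (f b) k) (f b)
                     (trans (sym (apply-abⁱ f k)) image≡uᴺ) u≤y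
...   | j , y≡uʲ⁺¹ = ⊥-elim (<⇒≱ uᴺ<y y≤uᴺ)
  where
  image≺y : pow u (suc n) ≺ pow u (suc j)
  image≺y = subst₂ _≺_ image≡uᴺ (trans (++-identityʳ (f b)) y≡uʲ⁺¹)
                   (pres (a ∷ replicate (suc (suc k)) b) (b ∷ []) (differ a<b))
  uᴺ<y : length (pow u (suc n)) < length (f b)
  uᴺ<y = subst (length (pow u (suc n)) <_) (cong length (sym y≡uʲ⁺¹))
               (pow-≺⇒length-< u (suc n) (suc j) image≺y)
  y≤uᴺ : length (f b) ≤ length (pow u (suc n))
  y≤uᴺ = subst (length (f b) ≤_) (cong length (trans (sym (apply-abⁱ f k)) image≡uᴺ))
               (length-++-≤ʳ (f b) {(f a ++ pow (f b) k) ++ f b})
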